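{- Let $P$ be a finite poset, $\mathbb{S}$ a skew field containing an infinite field as a subfield, and $C$ a central element of $\mathbb{S}$. Let $u,v\in P$ be such that neither of $u,v$ covers the other. Then the noncommutative order toggles and elggots satisfy $T_uT_v=T_vT_u$, $E_uE_v=E_vE_u$, $T_uE_v=E_vT_u$, and $E_uT_v=T_vE_u$ (as partial maps $\mathbb{S}^P\dashrightarrow\mathbb{S}^P$, where defined).
   Context: $\mathbb{S}^P$ is the set of labelings $f:P\to\mathbb{S}$; products of maps denote composition. For $x\in\mathbb{S}$, $\overline{x}=x^{ -1}$, and the parallel sum of $z_1,\dots,z_m$ is $\overline{\overline{z_1}+\cdots+\overline{z_m}}$, written $\sum^{\parallel}_i z_i$. $\widehat P$ is $P$ with a new minimum $\widehat0$ and maximum $\widehat1$; $x\lessdot y$ means $y$ covers $x$ in $\widehat P$; extend $f$ by $f(\widehat0)=1$, $f(\widehat1)=C$. The noncommutative order toggle $T_v$ changes only the label at $v$: $(T_vf)(v)=\Big(\sum_{u\lessdot v}f(u)\Big)\overline{f(v)}\Big(\sum^{\parallel}_{u\gtrdot v}f(u)\Big)$. The elggot $E_v$ changes only the label at $v$: $(E_vf)(v)=\Big(\sum^{\parallel}_{u\gtrdot v}f(u)\Big)\overline{f(v)}\Big(\sum_{u\lessdot v}f(u)\Big)$. (Here $u$ ranges over $\widehat P$.) -}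

module Defs where

open import Level using (Level; _⊔_) renaming (suc to lsuc)
open import Data.Nat using (ℕ)
open import Data.Fin using (Fin)
import Data.Fin as F
open import Data.Fin.Properties using (any?)
open import Data.Product using (Σ; ∃; _×_; _,_; proj₁; proj₂)
open import Data.Sum using (_⊎_; inj₁; inj₂)
open import Data.Unit using (⊤; tt)
open import Data.Empty using (⊥)
open import Data.List using (List; []; _∷_; map; foldr; filter; allFin)
open import Data.List.Relation.Unary.All using (All)
open import Relation.Nullary using (¬_; Dec; yes; no; _×-dec_; ¬?)
open import Relation.Nullary.Decidable using (does)
open import Relation.Binary using (Decidable; IsPartialOrder)
open import Relation.Binary.PropositionalEquality using (_≡_; refl)
open import Algebra.Bundles using (Ring)
open import Data.Bool using (if_then_else_)

-- Skew fields (division rings).  The inverse is a total operation whose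
-- value at 0 is irrelevant; it is a two-sided inverse on nonzero elements.

record SkewField (c ℓ : Level) : Set (lsuc (c ⊔ ℓ)) where
  field
    ring : Ring c ℓ
  open Ring ring public
  field
    _⁻¹        : Carrier → Carrier
    ⁻¹-cong    : ∀ {x y} → x ≈ y → x ⁻¹ ≈ y ⁻¹
    0≉1        : ¬ (0# ≈ 1#)
    ⁻¹-inverseˡ : ∀ x → ¬ (x ≈ 0#) → (x ⁻¹) * x ≈ 1#
    ⁻¹-inverseʳ : ∀ x → ¬ (x ≈ 0#) → x * (x ⁻¹) ≈ 1#

-- "S contains an infinite field as a subfield": a subset K of S closed
-- under the field operations, commutative, and infinite (an injection ℕ → K).
record InfiniteSubfield {c ℓ : Level} (S : SkewField c ℓ) (p : Level)
       : Set (lsuc p ⊔ c ⊔ ℓ) where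
  open SkewField S
  field
    K       : Carrier → Set p
    K-resp  : ∀ {x y} → x ≈ y → K x → K y
    K-0     : K 0#
    K-1     : K 1#
    K-+     : ∀ {x y} → K x → K y → K (x + y)
    K-neg   : ∀ {x} → K x → K (- x)
    K-*     : ∀ {x y} → K x → K y → K (x * y)
    K-inv   : ∀ {x} → K x → ¬ (x ≈ 0#) → K (x ⁻¹)
    K-comm  : ∀ {x y} → K x → K y → x * y ≈ y * x
    K-infinite : Σ (ℕ → Carrier) λ e → (∀ i → K (e i)) × (∀ i j → e i ≈ e j → i ≡ j)

record FinPoset (n : ℕ) : Set₁ where
  field
    _≼_            : Fin n → Fin n → Set
    isPartialOrder : IsPartialOrder _≡_ _≼_
    _≼?_           : Decidable _≼_

-- P̂ = P with a new minimum ⊥̂ and a new maximum ⊤̂.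
data Hat (n : ℕ) : Set where
  ⊥̂ ⊤̂ : Hat n
  el   : Fin n → Hat n

allHat : ∀ {n} → List (Hat n)
allHat {n} = ⊥̂ ∷ ⊤̂ ∷ map el (allFin n)

_≟̂_ : ∀ {n} → Decidable {A = Hat n} _≡_
⊥̂ ≟̂ ⊥̂ = yes refl
⊥̂ ≟̂ ⊤̂ = no λ ()
⊥̂ ≟̂ el _ = no λ ()
⊤̂ ≟̂ ⊥̂ = no λ ()
⊤̂ ≟̂ ⊤̂ = yes refl
⊤̂ ≟̂ el _ = no λ ()
el _ ≟̂ ⊥̂ = no λ ()
el _ ≟̂ ⊤̂ = no λ ()
el a ≟̂ el b with a F.≟ b
... | yes refl = yes refl
... | no a≢b = no λ { refl → a≢b refl }

∃Hat? : ∀ {n p} {Q : Hat n → Set p} → (∀ x → Dec (Q x)) → Dec (∃ Q)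
∃Hat? {Q = Q} Q? with Q? ⊥̂ | Q? ⊤̂ | any? (λ a → Q? (el a))
... | yes q | _ | _ = yes (⊥̂ , q)
... | no _ | yes q | _ = yes (⊤̂ , q)
... | no _ | no _ | yes (a , q) = yes (el a , q)
... | no q₁ | no q₂ | no q₃ = no λ { (⊥̂ , q) → q₁ q ; (⊤̂ , q) → q₂ q ; (el a , q) → q₃ (a , q) }

module HatOrder {n : ℕ} (P : FinPoset n) where
  open FinPoset P

  data _≤̂_ : Hat n → Hat n → Set where
    ⊥̂≤  : ∀ {y} → ⊥̂ ≤̂ y
    ≤⊤̂  : ∀ {x} → x ≤̂ ⊤̂
    el≤ : ∀ {a b} → a ≼ b → el a ≤̂ el b

  _≤̂?_ : Decidable _≤̂_
  ⊥̂ ≤̂? y = yes ⊥̂≤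
  ⊤̂ ≤̂? ⊥̂ = no λ ()
  ⊤̂ ≤̂? ⊤̂ = yes ≤⊤̂
  ⊤̂ ≤̂? el _ = no λ ()
  el a ≤̂? ⊥̂ = no λ ()
  el a ≤̂? ⊤̂ = yes ≤⊤̂
  el a ≤̂? el b with a ≼? b
  ... | yes p = yes (el≤ p)
  ... | no ¬p = no λ { (el≤ p) → ¬p p }

  _<̂_ : Hat n → Hat n → Set
  x <̂ y = x ≤̂ y × ¬ (x ≡ y)

  _<̂?_ : Decidable _<̂_
  x <̂? y = (x ≤̂? y) ×-dec ¬? (x ≟̂ y)

  _⋖_ : Hat n → Hat n → Set
  x ⋖ y = x <̂ y × ¬ (∃ λ z → x <̂ z × z <̂ y)

  _⋖?_ : Decidable _⋖_
  x ⋖? y = (x <̂? y) ×-dec ¬? (∃Hat? (λ z → (x <̂? z) ×-dec (z <̂? y)))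

  lowerCovers : Fin n → List (Hat n)
  lowerCovers v = filter {P = λ x → x ⋖ el v} (λ x → x ⋖? el v) allHat

  upperCovers : Fin n → List (Hat n)
  upperCovers v = filter {P = λ x → el v ⋖ x} (λ x → el v ⋖? x) allHat

module Toggles {c ℓ : Level} (S : SkewField c ℓ) (C : SkewField.Carrier S)
               {n : ℕ} (P : FinPoset n) where
  open SkewField S
  open HatOrder P public

  Labeling : Set c
  Labeling = Fin n → Carrier

  ext : Labeling → Hat n → Carrier
  ext f ⊥̂ = 1#
  ext f ⊤̂ = C
  ext f (el a) = f a

  Σ⁺ : List Carrier → Carrier
  Σ⁺ = foldr _+_ 0#

  Σ⁻¹ : List Carrier → Carrier
  Σ⁻¹ zs = Σ⁺ (map _⁻¹ zs)

  Σ∥ : List Carrier → Carrier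
  Σ∥ zs = (Σ⁻¹ zs) ⁻¹

  below above : Labeling → Fin n → List Carrier
  below f v = map (ext f) (lowerCovers v)
  above f v = map (ext f) (upperCovers v)

  update : Labeling → Fin n → Carrier → Labeling
  update f v x w = if does (w F.≟ v) then x else f w

  T : Fin n → Labeling → Labeling
  T v f = update f v ((Σ⁺ (below f v) * (f v) ⁻¹) * Σ∥ (above f v))

  E : Fin n → Labeling → Labeling
  E v f = update f v ((Σ∥ (above f v) * (f v) ⁻¹) * Σ⁺ (below f v))

  -- T_v f and E_v f are defined exactly when all inverted quantities are
  -- nonzero: f(v), the labels f(u) for u ⋗ v, and the sum of their inverses.
  Defined : Fin n → Labeling → Set (c ⊔ ℓ)
  Defined v f = ¬ (f v ≈ 0#) × All (λ z → ¬ (z ≈ 0#)) (above f v)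
                × ¬ (Σ⁻¹ (above f v) ≈ 0#)

  DefinedT DefinedE : Fin n → Labeling → Set (c ⊔ ℓ)
  DefinedT = Defined
  DefinedE = Defined

  CommuteWhereDefined : (F G : Labeling → Labeling) (DF DG : Labeling → Set (c ⊔ ℓ)) → Set (c ⊔ ℓ)
  CommuteWhereDefined F G DF DG =
    ∀ f → DG f → DF (G f) → DF f → DG (F f) → ∀ w → F (G f) w ≈ G (F f) w

-- Both T_v and E_v are "local rules": they replace the label at v by a
-- value computed from the labels covered by v, the label of v itself, and
-- the labels covering v.  Hence:
--
--  * for u ≠ v with neither covering the other, applying a local rule at v
--    leaves everything a local rule at u reads unchanged (and vice versa),
--    so any two local rules at u and at v commute on the nose; this gives
--    all four identities when u ≠ v, with no definedness needed;
--  * for u = v, T_u T_u and E_u E_u trivially commute, while T_u and E_u are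
--    mutually inverse at u: the rules x ↦ (A x⁻¹) B and x ↦ (B x⁻¹) A undo
--    each other in a skew field whenever x and its image are nonzero.
module Submission where

open import Defs
open import Level using (Level; _⊔_)
open import Data.Nat using (ℕ)
open import Data.Fin using (Fin)
import Data.Fin as F
open import Data.Product using (_×_; _,_; proj₁; proj₂)
open import Data.List using (List; []; _∷_; map)
open import Data.List.Relation.Unary.All using (All; []; _∷_)
import Data.List.Relation.Unary.All as All
open import Data.List.Relation.Unary.All.Properties using (all-filter)
open import Data.Bool using (if_then_else_)
open import Data.Empty using (⊥-elim)
open import Relation.Nullary using (¬_; Dec; yes; no)
open import Relation.Nullary.Decidable using (dec-true; dec-false)
open import Relation.Binary.PropositionalEquality as ≡ using (_≡_; cong; cong₂)
import Relation.Binary.Reasoning.Setoid as SetoidReasoning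

module SkewFieldFacts {c ℓ : Level} (S : SkewField c ℓ) where
  open SkewField S
  open SetoidReasoning setoid

  nonzero-factors : ∀ p q → ¬ (p * q ≈ 0#) → ¬ (p ≈ 0#) × ¬ (q ≈ 0#)
  nonzero-factors p q pq≉0 =
    (λ p≈0 → pq≉0 (trans (*-cong p≈0 refl) (zeroˡ q))) ,
    (λ q≈0 → pq≉0 (trans (*-cong refl q≈0) (zeroʳ p)))

  right-inverse-unique : ∀ y w → ¬ (y ≈ 0#) → y * w ≈ 1# → w ≈ y ⁻¹
  right-inverse-unique y w y≉0 yw≈1 = begin
    w               ≈⟨ sym (*-identityˡ w) ⟩
    1# * w          ≈⟨ *-cong (sym (⁻¹-inverseˡ y y≉0)) refl ⟩
    (y ⁻¹ * y) * w  ≈⟨ *-assoc _ _ _ ⟩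
    y ⁻¹ * (y * w)  ≈⟨ *-cong refl yw≈1 ⟩
    y ⁻¹ * 1#       ≈⟨ *-identityʳ _ ⟩
    y ⁻¹            ∎

  cancel-⁻¹ʳ : ∀ p y → ¬ (y ≈ 0#) → (p * y) * y ⁻¹ ≈ p
  cancel-⁻¹ʳ p y y≉0 = begin
    (p * y) * y ⁻¹  ≈⟨ *-assoc _ _ _ ⟩
    p * (y * y ⁻¹)  ≈⟨ *-cong refl (⁻¹-inverseʳ y y≉0) ⟩
    p * 1#          ≈⟨ *-identityʳ p ⟩
    p               ∎

  cancel-⁻¹ˡ : ∀ p y → ¬ (y ≈ 0#) → (p * y ⁻¹) * y ≈ p
  cancel-⁻¹ˡ p y y≉0 = begin
    (p * y ⁻¹) * y  ≈⟨ *-assoc _ _ _ ⟩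
    p * (y ⁻¹ * y)  ≈⟨ *-cong refl (⁻¹-inverseˡ y y≉0) ⟩
    p * 1#          ≈⟨ *-identityʳ p ⟩
    p               ∎

  nonzero-product : ∀ {p q} → ¬ (p ≈ 0#) → ¬ (q ≈ 0#) → ¬ (p * q ≈ 0#)
  nonzero-product {p} {q} p≉0 q≉0 pq≈0 = p≉0 (begin
    p               ≈⟨ sym (cancel-⁻¹ʳ p q q≉0) ⟩
    (p * q) * q ⁻¹  ≈⟨ *-cong pq≈0 refl ⟩
    0# * q ⁻¹       ≈⟨ zeroˡ _ ⟩
    0#              ∎)

  ⁻¹-nonzero : ∀ {x} → ¬ (x ≈ 0#) → ¬ (x ⁻¹ ≈ 0#)
  ⁻¹-nonzero {x} x≉0 x⁻¹≈0 = 0≉1 (begin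
    0#         ≈⟨ sym (zeroˡ x) ⟩
    0# * x     ≈⟨ *-cong (sym x⁻¹≈0) refl ⟩
    x ⁻¹ * x   ≈⟨ ⁻¹-inverseˡ x x≉0 ⟩
    1#         ∎)

  conjugate-inverse : ∀ a b x → ¬ (a ≈ 0#) → ¬ (b ≈ 0#) → ¬ (x ≈ 0#) →
                      ((b * x ⁻¹) * a) ⁻¹ ≈ (a ⁻¹ * x) * b ⁻¹
  conjugate-inverse a b x a≉0 b≉0 x≉0 =
    sym (right-inverse-unique z _ z≉0 (begin
      z * ((a ⁻¹ * x) * b ⁻¹)    ≈⟨ sym (*-assoc _ _ _) ⟩
      (z * (a ⁻¹ * x)) * b ⁻¹    ≈⟨ *-cong (sym (*-assoc _ _ _)) refl ⟩
      ((z * a ⁻¹) * x) * b ⁻¹    ≈⟨ *-cong (*-cong (cancel-⁻¹ʳ _ a a≉0) refl) refl ⟩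
      ((b * x ⁻¹) * x) * b ⁻¹    ≈⟨ *-cong (cancel-⁻¹ˡ b x x≉0) refl ⟩
      b * b ⁻¹                   ≈⟨ ⁻¹-inverseʳ b b≉0 ⟩
      1#                         ∎))
    where
    z = (b * x ⁻¹) * a
    z≉0 : ¬ (z ≈ 0#)
    z≉0 = nonzero-product (nonzero-product b≉0 (⁻¹-nonzero x≉0)) a≉0

  sandwich-involution : ∀ a b x z → ¬ (x ≈ 0#) → ¬ (z ≈ 0#) →
                        z ≈ (b * x ⁻¹) * a → (a * z ⁻¹) * b ≈ x
  sandwich-involution a b x z x≉0 z≉0 z≈ = begin
    (a * z ⁻¹) * b                            ≈⟨ *-cong (*-cong refl (⁻¹-cong z≈)) refl ⟩
    (a * ((b * x ⁻¹) * a) ⁻¹) * b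
      ≈⟨ *-cong (*-cong refl (conjugate-inverse a b x a≉0 b≉0 x≉0)) refl ⟩
    (a * ((a ⁻¹ * x) * b ⁻¹)) * b             ≈⟨ *-cong (sym (*-assoc _ _ _)) refl ⟩
    ((a * (a ⁻¹ * x)) * b ⁻¹) * b             ≈⟨ cancel-⁻¹ˡ _ b b≉0 ⟩
    a * (a ⁻¹ * x)                            ≈⟨ sym (*-assoc _ _ _) ⟩
    (a * a ⁻¹) * x                            ≈⟨ *-cong (⁻¹-inverseʳ a a≉0) refl ⟩
    1# * x                                    ≈⟨ *-identityˡ x ⟩
    x                                         ∎
    where
    bx⁻¹a≉0 : ¬ ((b * x ⁻¹) * a ≈ 0#)
    bx⁻¹a≉0 e = z≉0 (trans z≈ e)
    a≉0 : ¬ (a ≈ 0#)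
    a≉0 = proj₂ (nonzero-factors (b * x ⁻¹) a bx⁻¹a≉0)
    b≉0 : ¬ (b ≈ 0#)
    b≉0 = proj₁ (nonzero-factors b (x ⁻¹) (proj₁ (nonzero-factors (b * x ⁻¹) a bx⁻¹a≉0)))

module LocalRules {c ℓ : Level} (S : SkewField c ℓ) (C : SkewField.Carrier S)
                  {n : ℕ} (P : FinPoset n) where
  open SkewField S using (Carrier; _≈_; _*_; _⁻¹; 0#; reflexive; trans; sym)
  open Toggles S C P

  update-at : ∀ (f : Labeling) v x → update f v x v ≡ x
  update-at f v x = cong (λ b → if b then x else f v) (dec-true (v F.≟ v) ≡.refl)

  update-off : ∀ (f : Labeling) v x w → ¬ (w ≡ v) → update f v x w ≡ f w
  update-off f v x w w≢v = cong (λ b → if b then x else f w) (dec-false (w F.≟ v) w≢v)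

  update-swap : ∀ (f : Labeling) u v x y → ¬ (u ≡ v) →
                ∀ w → update (update f v y) u x w ≡ update (update f u x) v y w
  update-swap f u v x y u≢v w with w F.≟ u | w F.≟ v
  ... | yes ≡.refl | yes ≡.refl = ⊥-elim (u≢v ≡.refl)
  ... | yes ≡.refl | no _       = ≡.refl
  ... | no _       | yes ≡.refl = ≡.refl
  ... | no _       | no _       = ≡.refl

  ext-update-off : ∀ (f : Labeling) v x h → ¬ (h ≡ el v) → ext (update f v x) h ≡ ext f h
  ext-update-off f v x ⊥̂ _ = ≡.refl
  ext-update-off f v x ⊤̂ _ = ≡.refl
  ext-update-off f v x (el a) a≢v = update-off f v x a (λ a≡v → a≢v (cong el a≡v))

  map-ext-update-off : ∀ (f : Labeling) v x (hs : List (Hat n)) → All (λ h → ¬ (h ≡ el v)) hs →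
                       map (ext (update f v x)) hs ≡ map (ext f) hs
  map-ext-update-off f v x [] [] = ≡.refl
  map-ext-update-off f v x (h ∷ hs) (h≢v ∷ hs≢v) =
    cong₂ _∷_ (ext-update-off f v x h h≢v) (map-ext-update-off f v x hs hs≢v)

  below-update : ∀ (f : Labeling) u v x → ¬ (el v ⋖ el u) → below (update f v x) u ≡ below f u
  below-update f u v x v⋖̸u = map-ext-update-off f v x (lowerCovers u)
    (All.map (λ { h⋖u ≡.refl → v⋖̸u h⋖u }) (all-filter (λ h → h ⋖? el u) allHat))

  above-update : ∀ (f : Labeling) u v x → ¬ (el u ⋖ el v) → above (update f v x) u ≡ above f u
  above-update f u v x u⋖̸v = map-ext-update-off f v x (upperCovers u)
    (All.map (λ { u⋖h ≡.refl → u⋖̸v u⋖h }) (all-filter (λ h → el u ⋖? h) allHat))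

  ⋖-irrefl : ∀ h → ¬ (h ⋖ h)
  ⋖-irrefl h ((_ , h≢h) , _) = h≢h ≡.refl

  Rule : Set c
  Rule = List Carrier → Carrier → List Carrier → Carrier

  apply : Rule → Fin n → Labeling → Labeling
  apply Φ v f = update f v (Φ (below f v) (f v) (above f v))

  rule-cong : ∀ (Φ : Rule) {bl bl′ x x′ ab ab′} → bl ≡ bl′ → x ≡ x′ → ab ≡ ab′ →
              Φ bl x ab ≡ Φ bl′ x′ ab′
  rule-cong Φ ≡.refl ≡.refl ≡.refl = ≡.refl

  -- T v and E v are, by definition, apply toggleRule v and apply elggotRule v.
  toggleRule elggotRule : Rule
  toggleRule bl x ab = (Σ⁺ bl * x ⁻¹) * Σ∥ ab
  elggotRule bl x ab = (Σ∥ ab * x ⁻¹) * Σ⁺ bl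

  apply-commute : ∀ (Φ Ψ : Rule) u v → ¬ (u ≡ v) → ¬ (el u ⋖ el v) → ¬ (el v ⋖ el u) →
                  ∀ f w → apply Φ u (apply Ψ v f) w ≡ apply Ψ v (apply Φ u f) w
  apply-commute Φ Ψ u v u≢v u⋖̸v v⋖̸u f w = begin
    update g u (Φ (below g u) (g u) (above g u)) w  ≡⟨ cong (λ x → update g u x w) reads-u ⟩
    update g u x w                                 ≡⟨ update-swap f u v x y u≢v w ⟩
    update h v y w                                 ≡⟨ cong (λ y′ → update h v y′ w) (≡.sym reads-v) ⟩
    update h v (Ψ (below h v) (h v) (above h v)) w  ∎
    where
    open ≡.≡-Reasoning
    x = Φ (below f u) (f u) (above f u)
    y = Ψ (below f v) (f v) (above f v)
    g = update f v y
    h = update f u x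
    reads-u : Φ (below g u) (g u) (above g u) ≡ x
    reads-u = rule-cong Φ (below-update f u v y v⋖̸u) (update-off f v y u u≢v) (above-update f u v y u⋖̸v)
    reads-v : Ψ (below h v) (h v) (above h v) ≡ y
    reads-v = rule-cong Ψ (below-update f v u x u⋖̸v) (update-off f u x v (λ v≡u → u≢v (≡.sym v≡u)))
                (above-update f v u x v⋖̸u)

  apply-twice-at : ∀ (Φ Ψ : Rule) u f →
                   apply Φ u (apply Ψ u f) u ≡ Φ (below f u) (apply Ψ u f u) (above f u)
  apply-twice-at Φ Ψ u f = ≡.trans (update-at g u _)
    (rule-cong Φ (below-update f u u y (⋖-irrefl _)) ≡.refl (above-update f u u y (⋖-irrefl _)))
    where
    y = Ψ (below f u) (f u) (above f u)
    g = update f u y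

  apply-twice-off : ∀ (Φ Ψ : Rule) u f w → ¬ (w ≡ u) → apply Φ u (apply Ψ u f) w ≡ f w
  apply-twice-off Φ Ψ u f w w≢u = ≡.trans (update-off (apply Ψ u f) u _ w w≢u) (update-off f u _ w w≢u)

  commute-pointwise : ∀ {F G : Labeling → Labeling} {DF DG : Labeling → Set (c ⊔ ℓ)} →
                      (∀ f w → F (G f) w ≡ G (F f) w) → CommuteWhereDefined F G DF DG
  commute-pointwise F∘G≡G∘F f _ _ _ _ w = reflexive (F∘G≡G∘F f w)

  commute-sym : ∀ {F G : Labeling → Labeling} {DF DG : Labeling → Set (c ⊔ ℓ)} →
                CommuteWhereDefined F G DF DG → CommuteWhereDefined G F DG DF
  commute-sym F∘G≈G∘F f DF-f DG-Ff DG-f DF-Gf w = sym (F∘G≈G∘F f DG-f DF-Gf DF-f DG-Ff w)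

  module _ (u : Fin n) where
    open SkewFieldFacts S using (sandwich-involution)

    toggle-after-elggot : ∀ f → ¬ (f u ≈ 0#) → ¬ (E u f u ≈ 0#) → T u (E u f) u ≈ f u
    toggle-after-elggot f fu≉0 Efu≉0 =
      trans (reflexive (apply-twice-at toggleRule elggotRule u f))
        (sandwich-involution _ _ (f u) (E u f u) fu≉0 Efu≉0 (reflexive (update-at f u _)))

    elggot-after-toggle : ∀ f → ¬ (f u ≈ 0#) → ¬ (T u f u ≈ 0#) → E u (T u f) u ≈ f u
    elggot-after-toggle f fu≉0 Tfu≉0 =
      trans (reflexive (apply-twice-at elggotRule toggleRule u f))
        (sandwich-involution _ _ (f u) (T u f u) fu≉0 Tfu≉0 (reflexive (update-at f u _)))

    -- Hence T_u E_u = E_u T_u (both are the identity) where defined.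
    toggle-elggot-commute : CommuteWhereDefined (T u) (E u) (DefinedT u) (DefinedE u)
    toggle-elggot-commute f _ DT-Ef DT-f DE-Tf w = by-cases (w F.≟ u)
      where
      by-cases : Dec (w ≡ u) → T u (E u f) w ≈ E u (T u f) w
      by-cases (yes ≡.refl) = trans (toggle-after-elggot f (proj₁ DT-f) (proj₁ DT-Ef))
                                    (sym (elggot-after-toggle f (proj₁ DT-f) (proj₁ DE-Tf)))
      by-cases (no w≢u) = reflexive (≡.trans (apply-twice-off toggleRule elggotRule u f w w≢u)
                                             (≡.sym (apply-twice-off elggotRule toggleRule u f w w≢u)))

  toggles-elggots-commute : ∀ u v → ¬ (el u ⋖ el v) → ¬ (el v ⋖ el u) →
    CommuteWhereDefined (T u) (T v) (DefinedT u) (DefinedT v)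
    × CommuteWhereDefined (E u) (E v) (DefinedE u) (DefinedE v)
    × CommuteWhereDefined (T u) (E v) (DefinedT u) (DefinedE v)
    × CommuteWhereDefined (E u) (T v) (DefinedE u) (DefinedT v)
  toggles-elggots-commute u v u⋖̸v v⋖̸u = by-cases (u F.≟ v)
    where
    by-cases : Dec (u ≡ v) →
      CommuteWhereDefined (T u) (T v) (DefinedT u) (DefinedT v)
      × CommuteWhereDefined (E u) (E v) (DefinedE u) (DefinedE v)
      × CommuteWhereDefined (T u) (E v) (DefinedT u) (DefinedE v)
      × CommuteWhereDefined (E u) (T v) (DefinedE u) (DefinedT v)
    -- u = v: a map commutes with itself, and T_u, E_u are mutually inverse.
    by-cases (yes ≡.refl) = commute-pointwise (λ _ _ → ≡.refl) , commute-pointwise (λ _ _ → ≡.refl)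
                          , toggle-elggot-commute u , commute-sym (toggle-elggot-commute u)
    -- u ≠ v: the local rules at u and at v do not see each other's updates.
    by-cases (no u≢v) = commute-pointwise (apply-commute toggleRule toggleRule u v u≢v u⋖̸v v⋖̸u)
                      , commute-pointwise (apply-commute elggotRule elggotRule u v u≢v u⋖̸v v⋖̸u)
                      , commute-pointwise (apply-commute toggleRule elggotRule u v u≢v u⋖̸v v⋖̸u)
                      , commute-pointwise (apply-commute elggotRule toggleRule u v u≢v u⋖̸v v⋖̸u)

-- Proposition 5.8.
proposition5p8 : ∀ {c ℓ p : Level} (S : SkewField c ℓ) → InfiniteSubfield S p →
    (C : SkewField.Carrier S) →
    (∀ x → SkewField._≈_ S (SkewField._*_ S C x) (SkewField._*_ S x C)) →
    ∀ {n} (P : FinPoset n) (u v : Fin n) →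
    let open Toggles S C P in
    ¬ (el u ⋖ el v) → ¬ (el v ⋖ el u) →
    CommuteWhereDefined (T u) (T v) (DefinedT u) (DefinedT v)
    × CommuteWhereDefined (E u) (E v) (DefinedE u) (DefinedE v)
    × CommuteWhereDefined (T u) (E v) (DefinedT u) (DefinedE v)
    × CommuteWhereDefined (E u) (T v) (DefinedE u) (DefinedT v)
proposition5p8 S _ C _ P = LocalRules.toggles-elggots-commute S C P
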